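{- Let $F$ be a forest, and let $S$, $G$, $R$, the rooting of $G$, $\kappa$, $\overline{w}$ and $\overline{\beta}$ be as described in the context. Then for every $x\in V(G)$, $\overline{w}(x)=\overline{\beta}(x)$.
   Context: All graphs are finite, simple, undirected. For a graph $H$, $\mathcal{N}(H)$ is the null space of its adjacency matrix, viewed as the set of functions $z:V(H)\to\mathbb{R}$ with $\sum_{y\in N_H(x)}z(y)=0$ for all $x\in V(H)$. Let $F$ be a forest. $S$ is the set of vertices $x$ of $F$ such that $z(x)\neq 0$ for some $z\in\mathcal{N}(F)$. $G$ is the forest whose edges are the edges of $F$ having at least one endpoint in $S$ and whose vertices are the endpoints of those edges (so $G$ has no isolated vertices). $R=V(G)\setminus S$. For any graph $H$, $\mathcal{N}_S(H)$ denotes the set of vectors in $\mathcal{N}(H)$ that are zero at every vertex of $H$ not in $S$. Each component of $G$ is regarded as a rooted tree rooted at some (arbitrarily chosen) vertex of $S$; for $x\in V(G)$, $\kappa(x)$ is the set of children of $x$ (every vertex of $R$ has at least one child). For $x\in V(G)$, $\overline{G}(x)$ is the subgraph of $G$ induced by $x$ and its descendants. The downward weight $\overline{w}$ is defined recursively: if $x\in S$, $\overline{w}(x)$ is the minimum number of nonzeros among vectors in $\mathcal{N}_S(\overline{G}(x))$ that are nonzero at $x$; if $x\in R$, $\overline{w}(x)=\min_{c\in\kappa(x)}\overline{w}(c)$. The function $\overline{\beta}:V(G)\to\mathbb{N}$ is defined recursively by $\overline{\beta}(x)=\min_{c\in\kappa(x)}\overline{\beta}(c)$ if $x\in R$ and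 $\overline{\beta}(x)=1+\sum_{c\in\kappa(x)}\overline{\beta}(c)$ if $x\in S$ (so $\overline{\beta}(x)=1$ for a leaf $x\in S$).
   Formalization: The null-space vectors in $\mathcal{N}(F)$ and $\mathcal{N}_S(\overline{G}(x))$, which define $S$ and $\overline{w}$, take values in ℚ instead of ℝ. -}

module Defs where

open import Data.Nat using (ℕ; zero; suc; _≤_)
import Data.Nat as N
open import Data.Fin using (Fin; zero; suc) renaming (_≟_ to _≟ᶠ_)
open import Data.Bool using (Bool; true; false; if_then_else_)
open import Data.Maybe using (Maybe; just; nothing)
import Data.Maybe.Properties as MP
open import Data.Rational using (ℚ; 0ℚ; _+_) renaming (_≟_ to _≟ℚ_)
open import Data.List using (List; []; _∷_; _++_; length)
open import Data.List.Relation.Unary.Linked using (Linked)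
open import Data.List.Relation.Unary.Unique.Propositional using (Unique)
open import Data.Product using (Σ; _×_; ∃-syntax)
open import Data.Sum using (_⊎_)
open import Relation.Nullary using (¬_; does)
open import Relation.Binary.PropositionalEquality using (_≡_; _≢_)

∑ : {n : ℕ} → (Fin n → ℚ) → ℚ
∑ {zero}  f = 0ℚ
∑ {suc n} f = f zero + ∑ (λ i → f (suc i))

∑ℕ : {n : ℕ} → (Fin n → ℕ) → ℕ
∑ℕ {zero}  f = 0
∑ℕ {suc n} f = f zero N.+ ∑ℕ (λ i → f (suc i))

Adjacency : ℕ → Set
Adjacency n = Fin n → Fin n → Bool

module _ {n : ℕ} (adj : Adjacency n) where

  Edge : Fin n → Fin n → Set
  Edge x y = adj x y ≡ true

  IsSimple : Set
  IsSimple = (∀ x y → adj x y ≡ adj y x) × (∀ x → adj x x ≡ false)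

  IsCycle : List (Fin n) → Set
  IsCycle [] = Data.Empty.⊥ where import Data.Empty
  IsCycle (v ∷ vs) = (2 ≤ length vs) × Unique (v ∷ vs) × Linked Edge ((v ∷ vs) ++ (v ∷ []))

  IsForest : Set
  IsForest = ∀ (c : List (Fin n)) → ¬ IsCycle c

  InNull : (Fin n → ℚ) → Set
  InNull z = ∀ x → ∑ (λ y → if adj x y then z y else 0ℚ) ≡ 0ℚ

  S : Fin n → Set
  S x = Σ (Fin n → ℚ) λ z → InNull z × z x ≢ 0ℚ

  GEdge : Fin n → Fin n → Set
  GEdge x y = Edge x y × (S x ⊎ S y)

  VG : Fin n → Set
  VG x = ∃[ y ] GEdge x y

  -- A rooting of G (one root, lying in S, per component), given by parent pointers.
  -- 'depth' witnesses that following parents terminates at a root.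
  record Rooting : Set where
    field
      parent   : Fin n → Maybe (Fin n)
      depth    : Fin n → ℕ
      outside  : ∀ x → ¬ VG x → parent x ≡ nothing
      parEdge  : ∀ x p → parent x ≡ just p → GEdge x p × depth x ≡ suc (depth p)
      rootS    : ∀ x → VG x → parent x ≡ nothing → S x
      edgeTree : ∀ x y → GEdge x y → (parent x ≡ just y) ⊎ (parent y ≡ just x)

  module _ (ρ : Rooting) where
    open Rooting ρ

    Child : Fin n → Fin n → Set
    Child x c = parent c ≡ just x

    isChild : Fin n → Fin n → Bool
    isChild x c = does (MP.≡-dec _≟ᶠ_ (parent c) (just x))

    -- Desc x y : y is x or a descendant of x, i.e. y ∈ V(Ḡ(x))
    data Desc (x : Fin n) : Fin n → Set where
      here : Desc x x
      step : ∀ {y p} → parent y ≡ just p → Desc x p → Desc x y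

    nnz : (Fin n → ℚ) → ℕ
    nnz z = ∑ℕ (λ v → if does (z v ≟ℚ 0ℚ) then 0 else 1)

    -- z ∈ N_S(Ḡ(x)), with z extended by 0 outside V(Ḡ(x)).
    -- Since z vanishes outside S ∩ V(Ḡ(x)), the neighbourhood sum in Ḡ(x) at u equals
    -- the sum over the F-neighbours of u.
    InNS : Fin n → (Fin n → ℚ) → Set
    InNS x z = (∀ v → ¬ Desc x v → z v ≡ 0ℚ)
             × (∀ v → ¬ S v → z v ≡ 0ℚ)
             × (∀ u → Desc x u → ∑ (λ v → if adj u v then z v else 0ℚ) ≡ 0ℚ)

    IsMinSupp : Fin n → ℕ → Set
    IsMinSupp x k = (Σ (Fin n → ℚ) λ z → InNS x z × z x ≢ 0ℚ × nnz z ≡ k)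
                  × (∀ z → InNS x z → z x ≢ 0ℚ → k ≤ nnz z)

    IsMinChild : Fin n → (Fin n → ℕ) → ℕ → Set
    IsMinChild x f m = (Σ (Fin n) λ c → Child x c × f c ≡ m)
                     × (∀ c → Child x c → m ≤ f c)

    IsWbar : (Fin n → ℕ) → Set
    IsWbar w = ∀ x → VG x → (S x → IsMinSupp x (w x)) × (¬ S x → IsMinChild x w (w x))

    IsBetabar : (Fin n → ℕ) → Set
    IsBetabar b = ∀ x → VG x
                → (S x → b x ≡ suc (∑ℕ (λ c → if isChild x c then b c else 0)))
                × (¬ S x → IsMinChild x b (b x))

{-# OPTIONS --safe #-}
-- A vector vanishing off S only sees the edges of the rooted forest G, since every edge of F at a vertex
-- of S lies in G. S and R are the even and odd levels of G: adjacent x, c ∈ S are impossible, because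
-- restricting a null vector nonzero at c to the levels of c in Ḡ(c) leaves a vector whose neighbour sums
-- vanish except at x, contradicting the symmetry of the adjacency matrix against a null vector nonzero at x.
-- For x ∈ S, a vector z ∈ 𝒩_S(Ḡ(x)) with z(x) ≠ 0 splits into its restrictions to the subtrees of the
-- children c ∈ R of x. The equation at c forces z(g) ≠ 0 for some grandchild g, so by induction the part
-- below c has at least β̄(g) ≥ β̄(c) nonzeros. Conversely, 1 at x together with, below each child c, an
-- optimal vector of a minimising grandchild scaled to cancel the equation at c attains 1 + Σ β̄(c) = β̄(x).
-- Hence w̄ = β̄ on S, and on R both are the minimum of equal values over the children.
module Submission where

open import Defs
open import Data.Nat using (ℕ)
open import Data.Fin using (Fin)
open import Data.Product using (Σ; _×_)
open import Relation.Binary.PropositionalEquality using (_≡_)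

open import Algebra.Bundles using (CommutativeMonoid; Ring)
open import Algebra.Core using (Op₂)
open import Algebra.Structures using (IsCommutativeMonoid)
open import Data.Bool using (Bool; true; false; if_then_else_; not)
import Data.Bool as Bool
import Data.Bool.Properties as Bool
open import Data.Fin using (zero; suc) renaming (_≟_ to _≟ᶠ_)
open import Data.Fin.Properties using (any?; suc-injective)
open import Data.List using (List; []; _∷_; allFin)
import Data.List as List
open import Data.List.Membership.Propositional using (_∈_)
open import Data.List.Membership.Propositional.Properties using (∈-allFin; ∈-filter⁺; ∈-filter⁻)
open import Data.List.Relation.Unary.Any using (here; there)
import Data.List.Relation.Unary.All as AllList
import Data.List.Relation.Unary.All.Properties as AllList
open import Data.Maybe using (just; nothing; maybe′)
import Data.Maybe.Properties as MP
open import Data.Nat using (zero; suc; _≤_; _<_; _∸_; z≤n; s≤s) renaming (_+_ to _+ℕ_)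
open import Data.Nat.Induction using (<-wellFounded)
import Data.Nat.Properties as ℕ
open import Data.List.Extrema ℕ.≤-totalOrder using (max; xs≤max; argmin; argmin-sel; f[argmin]≤f[⊤]; f[argmin]≤f[xs])
open import Data.Product using (_,_; proj₁; proj₂)
open import Data.Rational using (ℚ; 0ℚ; 1ℚ; _+_; _*_; -_; 1/_; ≢-nonZero) renaming (_≟_ to _≟ℚ_)
import Data.Rational.Properties as ℚ
open import Data.Sum using (_⊎_; inj₁; inj₂)
import Data.Sum as Sum
open import Function using (_∘_; id; _⇔_; mk⇔; Equivalence)
open import Induction.WellFounded using (module All)
open import Level using (0ℓ)
import Relation.Binary.Construct.On as On
open import Relation.Binary.PropositionalEquality using (_≢_; refl; sym; trans; cong; cong₂; subst; _≗_; module ≡-Reasoning)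
open import Relation.Nullary using (¬_; ¬?; Dec; yes; no; does; contradiction; _⊎-dec_; _×-dec_)
import Relation.Nullary.Decidable as Dec
open import Relation.Unary using (Decidable)

-- ∑ and ∑ℕ unfold exactly like the library's sum, so its lemmas transfer along ∑′≡sum.
module FiniteSums
  {A : Set} {_∙_ : Op₂ A} {ε : A} (isCM : IsCommutativeMonoid _≡_ _∙_ ε)
  (∑′ : ∀ {m} → (Fin m → A) → A)
  (∑′-zero : (f : Fin 0 → A) → ∑′ f ≡ ε)
  (∑′-suc : ∀ {m} (f : Fin (suc m) → A) → ∑′ f ≡ f zero ∙ ∑′ (f ∘ suc))
  where

  open IsCommutativeMonoid isCM using (identityˡ; identityʳ)
  commutativeMonoid : CommutativeMonoid 0ℓ 0ℓ
  commutativeMonoid = record { isCommutativeMonoid = isCM }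

  open import Algebra.Properties.CommutativeMonoid.Sum commutativeMonoid as Lib using (sum)

  ∑′≡sum : ∀ {m} (f : Fin m → A) → ∑′ f ≡ sum f
  ∑′≡sum {zero}  f = ∑′-zero f
  ∑′≡sum {suc m} f = trans (∑′-suc f) (cong (f zero ∙_) (∑′≡sum (f ∘ suc)))

  ∑-cong : ∀ {m} {f g : Fin m → A} → f ≗ g → ∑′ f ≡ ∑′ g
  ∑-cong {f = f} {g} f≗g =
    trans (∑′≡sum f) (trans (Lib.sum-cong-≗ f≗g) (sym (∑′≡sum g)))

  ∑-distrib : ∀ {m} (f g : Fin m → A) → ∑′ (λ i → f i ∙ g i) ≡ ∑′ f ∙ ∑′ g
  ∑-distrib f g = begin
    ∑′ (λ i → f i ∙ g i)  ≡⟨ ∑′≡sum _ ⟩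
    sum (λ i → f i ∙ g i) ≡⟨ Lib.∑-distrib-+ f g ⟩
    sum f ∙ sum g         ≡⟨ sym (cong₂ _∙_ (∑′≡sum f) (∑′≡sum g)) ⟩
    ∑′ f ∙ ∑′ g           ∎
    where open ≡-Reasoning

  ∑-comm : ∀ {m l} (f : Fin m → Fin l → A) → ∑′ (λ i → ∑′ (f i)) ≡ ∑′ (λ j → ∑′ (λ i → f i j))
  ∑-comm {m} {l} f = begin
    ∑′ (λ i → ∑′ (f i))               ≡⟨ ∑′≡sum _ ⟩
    sum (λ i → ∑′ (f i))              ≡⟨ Lib.sum-cong-≗ (λ i → ∑′≡sum (f i)) ⟩
    sum (λ i → sum (f i))             ≡⟨ Lib.∑-comm {m} {l} f ⟩
    sum (λ j → sum (λ i → f i j))     ≡⟨ Lib.sum-cong-≗ (λ j → sym (∑′≡sum (λ i → f i j))) ⟩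
    sum (λ j → ∑′ (λ i → f i j))      ≡⟨ sym (∑′≡sum _) ⟩
    ∑′ (λ j → ∑′ (λ i → f i j))       ∎
    where open ≡-Reasoning

  ∑-ε : ∀ {m} {f : Fin m → A} → (∀ i → f i ≡ ε) → ∑′ f ≡ ε
  ∑-ε {m} f≗ε = trans (∑-cong f≗ε) (trans (∑′≡sum _) (Lib.sum-replicate-zero m))

  ∑-single : ∀ {m} {f : Fin m → A} (a : Fin m) → (∀ i → i ≢ a → f i ≡ ε) → ∑′ f ≡ f a
  ∑-single {suc m} {f} zero others = begin
    ∑′ f                   ≡⟨ ∑′-suc f ⟩
    f zero ∙ ∑′ (f ∘ suc)  ≡⟨ cong (f zero ∙_) (∑-ε (λ i → others (suc i) λ ())) ⟩
    f zero ∙ ε             ≡⟨ identityʳ (f zero) ⟩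
    f zero                 ∎
    where open ≡-Reasoning
  ∑-single {suc m} {f} (suc a) others = begin
    ∑′ f                   ≡⟨ ∑′-suc f ⟩
    f zero ∙ ∑′ (f ∘ suc)  ≡⟨ cong₂ _∙_ (others zero λ ())
                                        (∑-single a λ i i≢a → others (suc i) (i≢a ∘ suc-injective)) ⟩
    ε ∙ f (suc a)          ≡⟨ identityˡ (f (suc a)) ⟩
    f (suc a)              ∎
    where open ≡-Reasoning

  ∑-if : ∀ {m} (b : Bool) (f : Fin m → A) → ∑′ (λ i → if b then f i else ε) ≡ (if b then ∑′ f else ε)
  ∑-if true  f = refl
  ∑-if false f = ∑-ε (λ _ → refl)

  ∑[_]_ : ∀ {m} {P : Fin m → Set} → Decidable P → (Fin m → A) → A
  ∑[ P? ] f = ∑′ (λ i → if does (P? i) then f i else ε)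

  module _ {m} {P : Fin m → Set} (P? : Decidable P) where

    private
      if-cong : ∀ {Q : Set} (q? : Dec Q) {a b : A} → (Q → a ≡ b) →
                (if does q? then a else ε) ≡ (if does q? then b else ε)
      if-cong (yes q) a≡b = a≡b q
      if-cong (no _)  _   = refl

      if-ε : ∀ {Q : Set} (q? : Dec Q) {a : A} → (Q → a ≡ ε) → (if does q? then a else ε) ≡ ε
      if-ε (yes q) a≡ε = a≡ε q
      if-ε (no _)  _   = refl

    ∑[]-cong : ∀ {f g : Fin m → A} → (∀ i → P i → f i ≡ g i) → ∑[ P? ] f ≡ ∑[ P? ] g
    ∑[]-cong f≗g = ∑-cong (λ i → if-cong (P? i) (f≗g i))

    ∑[]-ε : ∀ {f : Fin m → A} → (∀ i → P i → f i ≡ ε) → ∑[ P? ] f ≡ ε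
    ∑[]-ε f≗ε = ∑-ε (λ i → if-ε (P? i) (f≗ε i))

    ∑[]-single : ∀ {f : Fin m → A} {a} → P a → (∀ i → P i → i ≢ a → f i ≡ ε) → ∑[ P? ] f ≡ f a
    ∑[]-single {f} {a} Pa others =
      trans (∑-single a (λ i i≢a → if-ε (P? i) (λ Pi → others i Pi i≢a))) (at-a (P? a))
      where
      at-a : (d : Dec (P a)) → (if does d then f a else ε) ≡ f a
      at-a (yes _)  = refl
      at-a (no ¬Pa) = contradiction Pa ¬Pa

    ∑[]-comm : ∀ {l} (f : Fin m → Fin l → A) →
               ∑′ (λ j → ∑[ P? ] (λ i → f i j)) ≡ ∑[ P? ] (λ i → ∑′ (f i))
    ∑[]-comm f = trans (sym (∑-comm (λ i j → if does (P? i) then f i j else ε)))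
                       (∑-cong (λ i → ∑-if (does (P? i)) (f i)))

open FiniteSums ℚ.+-0-isCommutativeMonoid ∑ (λ _ → refl) (λ _ → refl)
open FiniteSums ℕ.+-0-isCommutativeMonoid ∑ℕ (λ _ → refl) (λ _ → refl) using () renaming
  ( ∑-cong to ∑ℕ-cong; ∑-distrib to ∑ℕ-distrib; ∑[_]_ to ∑ℕ[_]_
  ; ∑[]-cong to ∑ℕ[]-cong; ∑[]-ε to ∑ℕ[]-zero; ∑[]-single to ∑ℕ[]-single; ∑[]-comm to ∑ℕ[]-comm)

∑-scale : ∀ {m} (k : ℚ) (f : Fin m → ℚ) → ∑ (λ i → k * f i) ≡ k * ∑ f
∑-scale k f = trans (∑′≡sum (λ i → k * f i)) (sym (trans (cong (k *_) (∑′≡sum f)) (*-distribˡ-sum k f)))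
  where open import Algebra.Properties.Semiring.Sum (Ring.semiring ℚ.+-*-ring) using (*-distribˡ-sum)

∑ℕ-mono : ∀ {m} {f g : Fin m → ℕ} → (∀ i → f i ≤ g i) → ∑ℕ f ≤ ∑ℕ g
∑ℕ-mono {zero}  _   = z≤n
∑ℕ-mono {suc m} f≤g = ℕ.+-mono-≤ (f≤g zero) (∑ℕ-mono (f≤g ∘ suc))

∑ℕ[]-mono : ∀ {m} {P : Fin m → Set} (P? : Decidable P) {f g : Fin m → ℕ} →
            (∀ i → P i → f i ≤ g i) → ∑ℕ[ P? ] f ≤ ∑ℕ[ P? ] g
∑ℕ[]-mono P? f≤g = ∑ℕ-mono (λ i → if-mono (P? i) (f≤g i))
  where
  if-mono : ∀ {Q : Set} (q? : Dec Q) {a b : ℕ} → (Q → a ≤ b) → (if does q? then a else 0) ≤ (if does q? then b else 0)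
  if-mono (yes q) a≤b = a≤b q
  if-mono (no _)  _   = z≤n

*-≢0 : ∀ {p q} → p ≢ 0ℚ → q ≢ 0ℚ → p * q ≢ 0ℚ
*-≢0 {p} {q} p≢0 q≢0 pq≡0 = q≢0 (begin
  q                 ≡⟨ sym (ℚ.*-identityˡ q) ⟩
  1ℚ * q            ≡⟨ cong (_* q) (sym (ℚ.*-inverseˡ p)) ⟩
  (1/ p) * p * q    ≡⟨ ℚ.*-assoc (1/ p) p q ⟩
  (1/ p) * (p * q)  ≡⟨ cong ((1/ p) *_) pq≡0 ⟩
  (1/ p) * 0ℚ       ≡⟨ ℚ.*-zeroʳ (1/ p) ⟩
  0ℚ                ∎)
  where
  open ≡-Reasoning
  instance _ = ≢-nonZero p≢0

choose : ∀ {m} {A : Set} {P : Fin m → Set} {Q : Fin m → A → Set} → Decidable P → A →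
         (∀ i → P i → Σ A (Q i)) → Σ (Fin m → A) λ f → ∀ i → P i → Q i (f i)
choose {A = A} {P = P} {Q = Q} P? default h = (λ i → value (P? i)) , (λ i → spec (P? i))
  where
  value : ∀ {i} → Dec (P i) → A
  value {i} (yes p) = proj₁ (h i p)
  value     (no _)  = default
  spec : ∀ {i} (d : Dec (P i)) → P i → Q i (value d)
  spec {i} (yes p) _  = proj₂ (h i p)
  spec     (no ¬p) p  = contradiction p ¬p

-- 0 on the empty list; this junk value never matters, since every vertex of R has a child.
minOver : ∀ {A : Set} → (A → ℕ) → List A → ℕ
minOver f []       = 0
minOver f (c ∷ cs) = f (argmin f c cs)

module _ {A : Set} {f : A → ℕ} where

  minOver-≤ : ∀ {c cs} → c ∈ cs → minOver f cs ≤ f c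
  minOver-≤ {cs = c₀ ∷ cs} (here refl)  = f[argmin]≤f[⊤] {f = f} c₀ cs
  minOver-≤ {cs = c₀ ∷ cs} (there c∈cs) = AllList.lookup (f[argmin]≤f[xs] {f = f} c₀ cs) c∈cs

  minOver-attained : ∀ {c cs} → c ∈ cs → Σ A λ c′ → c′ ∈ cs × f c′ ≡ minOver f cs
  minOver-attained {cs = c₀ ∷ cs} _ with argmin-sel f c₀ cs
  ... | inj₁ argmin≡c₀ = c₀ , here refl , cong f (sym argmin≡c₀)
  ... | inj₂ argmin∈cs = argmin f c₀ cs , there argmin∈cs , refl

minOver-cong : ∀ {A : Set} {f g : A → ℕ} cs → (∀ {c} → c ∈ cs → f c ≡ g c) → minOver f cs ≡ minOver g cs
minOver-cong []       _   = refl
minOver-cong (c ∷ cs) f≡g = ℕ.≤-antisym (bound f≡g) (bound (sym ∘ f≡g))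
  where
  bound : ∀ {f g} → (∀ {c′} → c′ ∈ c ∷ cs → f c′ ≡ g c′) → minOver f (c ∷ cs) ≤ minOver g (c ∷ cs)
  bound {f} {g} f≡g =
    let (c′ , c′∈cs , gc′≡min) = minOver-attained {f = g} (here refl)
    in ℕ.≤-trans (minOver-≤ {f = f} c′∈cs) (ℕ.≤-reflexive (trans (f≡g c′∈cs) gc′≡min))

module Forest {n : ℕ} (adj : Adjacency n) (simple : IsSimple adj) (ρ : Rooting adj) where

  open Rooting ρ

  _▸_ : Fin n → Fin n → Set
  _▸_ = Child adj ρ

  _≼_ : Fin n → Fin n → Set
  _≼_ = Desc adj ρ

  InS : Fin n → Set
  InS = S adj

  InG : Fin n → Set
  InG = VG adj

  child? : ∀ x c → Dec (x ▸ c)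
  child? x c = MP.≡-dec _≟ᶠ_ (parent c) (just x)

  ▸-depth : ∀ {x c} → x ▸ c → depth c ≡ suc (depth x)
  ▸-depth {x} {c} x▸c = proj₂ (parEdge c x x▸c)

  ▸-<-depth : ∀ {x c} → x ▸ c → depth x < depth c
  ▸-<-depth x▸c = ℕ.≤-reflexive (sym (▸-depth x▸c))

  ▸-GEdge : ∀ {x c} → x ▸ c → GEdge adj c x
  ▸-GEdge {x} {c} x▸c = proj₁ (parEdge c x x▸c)

  ▸-adj : ∀ {x c} → x ▸ c → adj x c ≡ true
  ▸-adj {x} {c} x▸c = trans (proj₁ simple x c) (proj₁ (▸-GEdge x▸c))

  ▸-InG-child : ∀ {x c} → x ▸ c → InG c
  ▸-InG-child {x} x▸c = x , ▸-GEdge x▸c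

  ▸-InG-parent : ∀ {x c} → x ▸ c → InG x
  ▸-InG-parent {x} {c} x▸c = c , ▸-adj x▸c , Sum.swap (proj₂ (▸-GEdge x▸c))

  ▸-unique : ∀ {x y c} → x ▸ c → y ▸ c → x ≡ y
  ▸-unique x▸c y▸c = MP.just-injective (trans (sym x▸c) y▸c)

  ≼-depth : ∀ {x v} → x ≼ v → depth x ≤ depth v
  ≼-depth here        = ℕ.≤-refl
  ≼-depth (step p▸v d) = ℕ.≤-trans (≼-depth d) (ℕ.<⇒≤ (▸-<-depth p▸v))

  ≼-trans : ∀ {x y v} → x ≼ y → y ≼ v → x ≼ v
  ≼-trans x≼y here          = x≼y
  ≼-trans x≼y (step p▸v y≼p) = step p▸v (≼-trans x≼y y≼p)

  ▸-≼ : ∀ {x c v} → x ▸ c → c ≼ v → x ≼ v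
  ▸-≼ x▸c = ≼-trans (step x▸c here)

  ≼-parent : ∀ {x v p} → x ≼ v → v ≢ x → p ▸ v → x ≼ p
  ≼-parent here           v≢x _   = contradiction refl v≢x
  ≼-parent (step q▸v x≼q) _   p▸v = subst (_ ≼_) (▸-unique q▸v p▸v) x≼q

  child-not-above : ∀ {x c} → x ▸ c → ¬ c ≼ x
  child-not-above x▸c c≼x = ℕ.<⇒≱ (▸-<-depth x▸c) (≼-depth c≼x)

  ≼-ancestors-unique : ∀ {x y v} → x ≼ v → y ≼ v → depth x ≡ depth y → x ≡ y
  ≼-ancestors-unique here here _ = refl
  ≼-ancestors-unique here (step p▸v y≼p) dx≡dy =
    contradiction (ℕ.≤-<-trans (≼-depth y≼p) (▸-<-depth p▸v)) (ℕ.<-irrefl (sym dx≡dy))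
  ≼-ancestors-unique (step p▸v x≼p) here dx≡dy =
    contradiction (ℕ.≤-<-trans (≼-depth x≼p) (▸-<-depth p▸v)) (ℕ.<-irrefl dx≡dy)
  ≼-ancestors-unique (step p▸v x≼p) (step q▸v y≼q) dx≡dy =
    ≼-ancestors-unique x≼p (subst (_ ≼_) (▸-unique q▸v p▸v) y≼q) dx≡dy

  siblings-disjoint : ∀ {x c c′ v} → x ▸ c → x ▸ c′ → c ≼ v → c′ ≼ v → c ≡ c′
  siblings-disjoint x▸c x▸c′ c≼v c′≼v =
    ≼-ancestors-unique c≼v c′≼v (trans (▸-depth x▸c) (sym (▸-depth x▸c′)))

  ≼-split : ∀ {x v} → x ≼ v → v ≢ x → Σ (Fin n) λ c → x ▸ c × c ≼ v
  ≼-split here v≢x = contradiction refl v≢x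
  ≼-split {x} {v} (step {p = p} p▸v x≼p) _ with p ≟ᶠ x
  ... | yes refl = v , p▸v , here
  ... | no p≢x   = let (c , x▸c , c≼p) = ≼-split x≼p p≢x in c , x▸c , step p▸v c≼p

  parent-induction : {P : Fin n → Set} → (∀ x → parent x ≡ nothing → P x) →
                     (∀ {p x} → p ▸ x → P p → P x) → ∀ x → P x
  parent-induction {P} root child =
    All.wfRec (On.wellFounded depth <-wellFounded) _ P induct
    where
    induct : ∀ x → (∀ {p} → depth p < depth x → P p) → P x
    induct x ih with parent x in eq
    ... | nothing = root x eq
    ... | just p  = child eq (ih (▸-<-depth eq))

  maxDepth : ℕ
  maxDepth = max 0 (List.map depth (allFin n))

  height : Fin n → ℕ
  height x = maxDepth ∸ depth x

  ▸-height : ∀ {x c} → x ▸ c → height c < height x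
  ▸-height {c = c} x▸c = ℕ.∸-monoʳ-< (▸-<-depth x▸c) depth≤maxDepth
    where
    depth≤maxDepth : depth c ≤ maxDepth
    depth≤maxDepth = AllList.lookup (AllList.map⁻ (xs≤max 0 (List.map depth (allFin n)))) (∈-allFin c)

  descendant-induction : {P : Fin n → Set} → (∀ x → (∀ {c y} → x ▸ c → c ≼ y → P y) → P x) → ∀ x → P x
  descendant-induction {P} step′ =
    All.wfRec (On.wellFounded height <-wellFounded) _ P
      (λ x ih → step′ x (λ x▸c c≼y → ih (ℕ.≤-<-trans (ℕ.∸-monoʳ-≤ maxDepth (≼-depth c≼y)) (▸-height x▸c))))

  desc? : ∀ x v → Dec (x ≼ v)
  desc? x = parent-induction root child
    where
    root : ∀ v → parent v ≡ nothing → Dec (x ≼ v)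
    root v v-root with x ≟ᶠ v
    ... | yes refl = yes here
    ... | no x≢v   = no λ { here → x≢v refl ; (step p▸v _) → contradiction (trans (sym v-root) p▸v) λ () }
    child : ∀ {p v} → p ▸ v → Dec (x ≼ p) → Dec (x ≼ v)
    child p▸v (yes x≼p) = yes (step p▸v x≼p)
    child {v = v} p▸v (no x⋠p) with x ≟ᶠ v
    ... | yes refl = yes here
    ... | no x≢v   = no λ { here → x≢v refl ; (step q▸v x≼q) → x⋠p (subst (x ≼_) (▸-unique q▸v p▸v) x≼q) }

  -- the parity of the distance to the root; depth itself is only required to grow by one along edges
  evenAt : ℕ → Fin n → Bool
  evenAt zero    _ = true
  evenAt (suc k) x = maybe′ (λ p → not (evenAt k p)) true (parent x)

  evenLevel : Fin n → Bool
  evenLevel x = evenAt (depth x) x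

  evenLevel-child : ∀ {x c} → x ▸ c → evenLevel c ≡ not (evenLevel x)
  evenLevel-child x▸c rewrite ▸-depth x▸c | x▸c = refl

  evenLevel-root : ∀ {x} → parent x ≡ nothing → evenLevel x ≡ true
  evenLevel-root {x} root with depth x
  ... | zero  = refl
  ... | suc _ rewrite root = refl

  -- Vectors vanishing off S

  Supported : (Fin n → ℚ) → Set
  Supported f = ∀ v → ¬ InS v → f v ≡ 0ℚ

  VanishesOutside : Fin n → (Fin n → ℚ) → Set
  VanishesOutside g f = ∀ v → ¬ g ≼ v → f v ≡ 0ℚ

  null⇒supported : ∀ {z} → InNull adj z → Supported z
  null⇒supported {z} z-null v ¬Sv with z v ≟ℚ 0ℚ
  ... | yes zv≡0 = zv≡0
  ... | no  zv≢0 = contradiction (z , z-null , zv≢0) ¬Sv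

  restrict : {P : Fin n → Set} → Decidable P → (Fin n → ℚ) → Fin n → ℚ
  restrict P? f v = if does (P? v) then f v else 0ℚ

  module _ {P : Fin n → Set} (P? : Decidable P) (f : Fin n → ℚ) where

    restrict-yes : ∀ {v} → P v → restrict P? f v ≡ f v
    restrict-yes {v} Pv with P? v
    ... | yes _  = refl
    ... | no ¬Pv = contradiction Pv ¬Pv

    restrict-no : ∀ {v} → ¬ P v → restrict P? f v ≡ 0ℚ
    restrict-no {v} ¬Pv with P? v
    ... | yes Pv = contradiction Pv ¬Pv
    ... | no _   = refl

    restrict-zero : ∀ {v} → f v ≡ 0ℚ → restrict P? f v ≡ 0ℚ
    restrict-zero {v} fv≡0 with P? v
    ... | yes _ = fv≡0
    ... | no _  = refl

    restrict-supported : Supported f → Supported (restrict P? f)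
    restrict-supported supp v ¬Sv = restrict-zero (supp v ¬Sv)

  TreeAdj : Fin n → Fin n → Set
  TreeAdj u v = u ▸ v ⊎ v ▸ u

  treeAdj? : ∀ u v → Dec (TreeAdj u v)
  treeAdj? u v = child? u v ⊎-dec child? v u

  treeAdj⇒adj : ∀ {u v} → TreeAdj u v → adj u v ≡ true
  treeAdj⇒adj (inj₁ u▸v) = ▸-adj u▸v
  treeAdj⇒adj (inj₂ v▸u) = proj₁ (▸-GEdge v▸u)

  neighbourSum : (Fin n → ℚ) → Fin n → ℚ
  neighbourSum f u = ∑ (λ v → if adj u v then f v else 0ℚ)

  neighbourSum-tree : ∀ {f u} → Supported f → neighbourSum f u ≡ ∑[ treeAdj? u ] f
  neighbourSum-tree {f} {u} supp = ∑-cong (λ v → term (treeAdj? u v))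
    where
    term : ∀ {v} (t? : Dec (TreeAdj u v)) → (if adj u v then f v else 0ℚ) ≡ (if does t? then f v else 0ℚ)
    term (yes t) rewrite treeAdj⇒adj t = refl
    term {v} (no ¬t) with adj u v in uv
    ... | false = refl
    ... | true  = supp v (λ Sv → ¬t (Sum.swap (edgeTree u v (uv , inj₂ Sv))))

  module _ {f : Fin n → ℚ} {u : Fin n} (supp : Supported f) where

    neighbourSum-local : ∀ {g} → Supported g → (∀ v → TreeAdj u v → f v ≡ g v) →
                         neighbourSum f u ≡ neighbourSum g u
    neighbourSum-local g-supp f≡g =
      trans (neighbourSum-tree supp) (trans (∑[]-cong (treeAdj? u) f≡g) (sym (neighbourSum-tree g-supp)))

    neighbourSum-zero : (∀ v → TreeAdj u v → f v ≡ 0ℚ) → neighbourSum f u ≡ 0ℚ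
    neighbourSum-zero f≡0 = trans (neighbourSum-tree supp) (∑[]-ε (treeAdj? u) f≡0)

    neighbourSum-single : ∀ {a} → TreeAdj u a → (∀ v → TreeAdj u v → v ≢ a → f v ≡ 0ℚ) →
                          neighbourSum f u ≡ f a
    neighbourSum-single ua others = trans (neighbourSum-tree supp) (∑[]-single (treeAdj? u) ua others)

  module _ {c g : Fin n} {f : Fin n → ℚ} (c▸g : c ▸ g) (supp : Supported f) (outside : VanishesOutside g f) where

    neighbourSum-at-parent : neighbourSum f c ≡ f g
    neighbourSum-at-parent = neighbourSum-single supp (inj₁ c▸g) others
      where
      others : ∀ v → TreeAdj c v → v ≢ g → f v ≡ 0ℚ
      others v (inj₁ c▸v) v≢g = outside v (λ g≼v → v≢g (sym (siblings-disjoint c▸g c▸v g≼v here)))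
      others v (inj₂ v▸c) _   = outside v (λ g≼v → child-not-above v▸c (▸-≼ c▸g g≼v))

    neighbourSum-outside : ∀ {u} → ¬ g ≼ u → u ≢ c → neighbourSum f u ≡ 0ℚ
    neighbourSum-outside {u} g⋠u u≢c = neighbourSum-zero supp nbr
      where
      below : ∀ {v} → u ▸ v → ¬ g ≼ v
      below {v} u▸v g≼v with v ≟ᶠ g
      ... | yes refl = u≢c (▸-unique u▸v c▸g)
      ... | no v≢g   = g⋠u (≼-parent g≼v v≢g u▸v)
      nbr : ∀ v → TreeAdj u v → f v ≡ 0ℚ
      nbr v (inj₁ u▸v) = outside v (below u▸v)
      nbr v (inj₂ v▸u) = outside v (λ g≼v → g⋠u (step v▸u g≼v))

  neighbourSum-+ : ∀ {f g u} → neighbourSum (λ v → f v + g v) u ≡ neighbourSum f u + neighbourSum g u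
  neighbourSum-+ {f} {g} {u} =
    trans (∑-cong term) (∑-distrib (λ v → if adj u v then f v else 0ℚ) (λ v → if adj u v then g v else 0ℚ))
    where
    term : ∀ v → (if adj u v then f v + g v else 0ℚ) ≡ (if adj u v then f v else 0ℚ) + (if adj u v then g v else 0ℚ)
    term v with adj u v
    ... | true  = refl
    ... | false = sym (ℚ.+-identityʳ 0ℚ)

  neighbourSum-∑[] : ∀ {P : Fin n → Set} (P? : Decidable P) (F : Fin n → Fin n → ℚ) {u} →
                     neighbourSum (λ v → ∑[ P? ] (λ c → F c v)) u ≡ ∑[ P? ] (λ c → neighbourSum (F c) u)
  neighbourSum-∑[] P? F {u} = trans (∑-cong term) (∑[]-comm P? (λ c v → if adj u v then F c v else 0ℚ))
    where
    term : ∀ v → (if adj u v then ∑[ P? ] (λ c → F c v) else 0ℚ) ≡ ∑[ P? ] (λ c → if adj u v then F c v else 0ℚ)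
    term v with adj u v
    ... | true  = refl
    ... | false = sym (∑[]-ε P? (λ _ _ → refl))

  pointMass : Fin n → ℚ → Fin n → ℚ
  pointMass a q v = if does (v ≟ᶠ a) then q else 0ℚ

  pointMass-off : ∀ {a q v} → v ≢ a → pointMass a q v ≡ 0ℚ
  pointMass-off {a} {q} {v} v≢a with v ≟ᶠ a
  ... | yes v≡a = contradiction v≡a v≢a
  ... | no _    = refl

  pointMass-at : ∀ a q → pointMass a q a ≡ q
  pointMass-at a _ with a ≟ᶠ a
  ... | yes _   = refl
  ... | no a≢a  = contradiction refl a≢a

  neighbourSum-pointMass : ∀ {a q u} → neighbourSum (pointMass a q) u ≡ (if adj u a then q else 0ℚ)
  neighbourSum-pointMass {a} {q} {u} = trans (∑-single a off-a) (cong (λ r → if adj u a then r else 0ℚ) (pointMass-at a q))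
    where
    off-a : ∀ v → v ≢ a → (if adj u v then pointMass a q v else 0ℚ) ≡ 0ℚ
    off-a v v≢a with adj u v
    ... | true  = pointMass-off v≢a
    ... | false = refl

  neighbourSum-symmetric : ∀ f g → ∑ (λ v → f v * neighbourSum g v) ≡ ∑ (λ v → g v * neighbourSum f v)
  neighbourSum-symmetric f g = begin
    ∑ (λ v → f v * neighbourSum g v)
      ≡⟨ ∑-cong (λ v → sym (∑-scale (f v) (λ w → if adj v w then g w else 0ℚ))) ⟩
    ∑ (λ v → ∑ (λ w → f v * (if adj v w then g w else 0ℚ)))
      ≡⟨ ∑-comm (λ v w → f v * (if adj v w then g w else 0ℚ)) ⟩
    ∑ (λ w → ∑ (λ v → f v * (if adj v w then g w else 0ℚ)))
      ≡⟨ ∑-cong (λ w → ∑-cong (term w)) ⟩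
    ∑ (λ w → ∑ (λ v → g w * (if adj w v then f v else 0ℚ)))
      ≡⟨ ∑-cong (λ w → ∑-scale (g w) (λ v → if adj w v then f v else 0ℚ)) ⟩
    ∑ (λ w → g w * neighbourSum f w)
      ∎
    where
    open ≡-Reasoning
    term : ∀ w v → f v * (if adj v w then g w else 0ℚ) ≡ g w * (if adj w v then f v else 0ℚ)
    term w v rewrite proj₁ simple w v with adj v w
    ... | true  = ℚ.*-comm (f v) (g w)
    ... | false = trans (ℚ.*-zeroʳ (f v)) (sym (ℚ.*-zeroʳ (g w)))

  -- S and R are the even and odd levels of G

  treeAdj-flips-level : ∀ {v w} → TreeAdj v w → evenLevel w ≡ not (evenLevel v)
  treeAdj-flips-level (inj₁ v▸w) = evenLevel-child v▸w
  treeAdj-flips-level {v} {w} (inj₂ w▸v) =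
    trans (sym (Bool.not-involutive (evenLevel w))) (cong not (sym (evenLevel-child w▸v)))

  S-independent : ∀ {x c} → x ▸ c → InS x → ¬ InS c
  S-independent {x} {c} x▸c (u , u-null , ux≢0) (z , z-null , zc≢0) =
    *-≢0 ux≢0 zc≢0 (trans (sym pairing-at-x) pairing-vanishes)
    where
    sameLevel? : Decidable (λ v → c ≼ v × evenLevel v ≡ evenLevel c)
    sameLevel? v = desc? c v ×-dec (evenLevel v Bool.≟ evenLevel c)

    z₁ : Fin n → ℚ
    z₁ = restrict sameLevel? z

    z-supp : Supported z
    z-supp = null⇒supported z-null

    z₁-supp : Supported z₁
    z₁-supp = restrict-supported sameLevel? z z-supp

    z₁-outside : VanishesOutside c z₁
    z₁-outside v c⋠v = restrict-no sameLevel? z (c⋠v ∘ proj₁)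

    z₁-sum-off-x : ∀ v → v ≢ x → neighbourSum z₁ v ≡ 0ℚ
    z₁-sum-off-x v v≢x with desc? c v
    ... | no c⋠v = neighbourSum-outside x▸c z₁-supp z₁-outside c⋠v v≢x
    ... | yes c≼v with evenLevel v Bool.≟ evenLevel c
    ...   | yes same = neighbourSum-zero z₁-supp λ w vw →
              restrict-no sameLevel? z (λ (_ , w-same) → Bool.not-¬ refl (trans same (trans (sym w-same) (treeAdj-flips-level vw))))
    ...   | no differ =
              trans (neighbourSum-local z₁-supp z-supp λ w vw → restrict-yes sameLevel? z (below w vw , level w vw))
                    (z-null v)
      where
      below : ∀ w → TreeAdj v w → c ≼ w
      below w (inj₁ v▸w) = step v▸w c≼v
      below w (inj₂ w▸v) = ≼-parent c≼v (λ v≡c → differ (cong evenLevel v≡c)) w▸v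
      level : ∀ w → TreeAdj v w → evenLevel w ≡ evenLevel c
      level w vw = trans (treeAdj-flips-level vw) (sym (Bool.¬-not (differ ∘ sym)))

    pairing-at-x : ∑ (λ v → u v * neighbourSum z₁ v) ≡ u x * z c
    pairing-at-x = begin
      ∑ (λ v → u v * neighbourSum z₁ v)  ≡⟨ ∑-single x (λ v v≢x → trans (cong (u v *_) (z₁-sum-off-x v v≢x))
                                                                        (ℚ.*-zeroʳ (u v))) ⟩
      u x * neighbourSum z₁ x            ≡⟨ cong (u x *_) (neighbourSum-at-parent x▸c z₁-supp z₁-outside) ⟩
      u x * z₁ c                         ≡⟨ cong (u x *_) (restrict-yes sameLevel? z (here , refl)) ⟩
      u x * z c                          ∎
      where open ≡-Reasoning

    pairing-vanishes : ∑ (λ v → u v * neighbourSum z₁ v) ≡ 0ℚ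
    pairing-vanishes = trans (neighbourSum-symmetric u z₁) (∑-ε λ v → trans (cong (z₁ v *_) (u-null v)) (ℚ.*-zeroʳ (z₁ v)))

  S⇔evenLevel : ∀ x → InG x → InS x ⇔ (evenLevel x ≡ true)
  S⇔evenLevel = parent-induction root child
    where
    root : ∀ x → parent x ≡ nothing → InG x → InS x ⇔ (evenLevel x ≡ true)
    root x x-root Gx = mk⇔ (λ _ → evenLevel-root x-root) (λ _ → rootS x Gx x-root)
    child : ∀ {p x} → p ▸ x → (InG p → InS p ⇔ (evenLevel p ≡ true)) → InG x → InS x ⇔ (evenLevel x ≡ true)
    child {p} {x} p▸x ih _ = mk⇔ to from
      where
      p-level = ih (▸-InG-parent p▸x)
      to : InS x → evenLevel x ≡ true
      to Sx = trans (evenLevel-child p▸x)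
                    (cong not (Bool.¬-not (λ p-even → S-independent p▸x (Equivalence.from p-level p-even) Sx)))
      from : evenLevel x ≡ true → InS x
      from x-even = Sum.[ id , (λ Sp → contradiction (trans (sym (Equivalence.to p-level Sp)) p-odd) λ ()) ]′
                          (proj₂ (▸-GEdge p▸x))
        where
        p-odd : evenLevel p ≡ false
        p-odd = Bool.not-injective (trans (sym (evenLevel-child p▸x)) x-even)

  S? : ∀ {x} → InG x → Dec (InS x)
  S? {x} Gx = Dec.map′ (Equivalence.from (S⇔evenLevel x Gx)) (Equivalence.to (S⇔evenLevel x Gx)) (evenLevel x Bool.≟ true)

  R-child-in-S : ∀ {c g} → ¬ InS c → c ▸ g → InS g
  R-child-in-S ¬Sc c▸g = Sum.[ id , (λ Sc → contradiction Sc ¬Sc) ]′ (proj₂ (▸-GEdge c▸g))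

  R-has-child : ∀ {x} → InG x → ¬ InS x → Σ (Fin n) (x ▸_)
  R-has-child {x} Gx ¬Sx with any? (child? x) | parent x in x-parent
  ... | yes has-child | _       = has-child
  ... | no childless  | nothing = contradiction (rootS x Gx x-parent) ¬Sx
  ... | no childless  | just p  =
    contradiction (Sum.[ (λ Sx → contradiction Sx ¬Sx) , id ]′ (proj₂ (▸-GEdge x-parent))) parent-not-in-S
    where
    parent-not-in-S : ¬ InS p
    parent-not-in-S (z , z-null , zp≢0) = zp≢0 (trans (sym only-parent) (z-null x))
      where
      others : ∀ v → TreeAdj x v → v ≢ p → z v ≡ 0ℚ
      others v (inj₁ x▸v) _   = contradiction (v , x▸v) childless
      others v (inj₂ v▸x) v≢p = contradiction (▸-unique v▸x x-parent) v≢p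
      only-parent : neighbourSum z x ≡ z p
      only-parent = neighbourSum-single (null⇒supported z-null) (inj₂ x-parent) others

  subtree-InNS : ∀ {x c g f} → x ≼ c → c ▸ g → f c ≡ 0ℚ → InNS adj ρ x f → InNS adj ρ g (restrict (desc? g) f)
  subtree-InNS {x} {c} {g} {f} x≼c c▸g fc≡0 (_ , f-supp , f-null) =
      (λ _ → restrict-no (desc? g) f)
    , f₁-supp
    , (λ u g≼u → trans (neighbourSum-local f₁-supp f-supp (agree g≼u)) (f-null u (≼-trans x≼c (▸-≼ c▸g g≼u))))
    where
    f₁-supp : Supported (restrict (desc? g) f)
    f₁-supp = restrict-supported (desc? g) f f-supp
    agree : ∀ {u} → g ≼ u → ∀ v → TreeAdj u v → restrict (desc? g) f v ≡ f v
    agree g≼u v (inj₁ u▸v) = restrict-yes (desc? g) f (step u▸v g≼u)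
    agree {u} g≼u v (inj₂ v▸u) with u ≟ᶠ g
    ... | yes refl = trans (restrict-no (desc? g) f (child-not-above v▸u))
                           (sym (trans (cong f (▸-unique v▸u c▸g)) fc≡0))
    ... | no u≢g   = restrict-yes (desc? g) f (≼-parent g≼u u≢g v▸u)

  -- Counting nonzeros

  𝟙≢0 : ℚ → ℕ
  𝟙≢0 q = if does (q ≟ℚ 0ℚ) then 0 else 1

  𝟙≢0-nonzero : ∀ {q} → q ≢ 0ℚ → 𝟙≢0 q ≡ 1
  𝟙≢0-nonzero {q} q≢0 with q ≟ℚ 0ℚ
  ... | yes q≡0 = contradiction q≡0 q≢0
  ... | no _    = refl

  ∥_∥₀ : (Fin n → ℚ) → ℕ
  ∥_∥₀ = nnz adj ρ

  ∥∥₀-cong : ∀ {f g} → f ≗ g → ∥ f ∥₀ ≡ ∥ g ∥₀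
  ∥∥₀-cong f≗g = ∑ℕ-cong (cong 𝟙≢0 ∘ f≗g)

  ∥∥₀-mono : ∀ {f g} → (∀ v → g v ≡ 0ℚ → f v ≡ 0ℚ) → ∥ f ∥₀ ≤ ∥ g ∥₀
  ∥∥₀-mono {f} {g} g≡0⇒f≡0 = ∑ℕ-mono pointwise
    where
    pointwise : ∀ v → 𝟙≢0 (f v) ≤ 𝟙≢0 (g v)
    pointwise v with g v ≟ℚ 0ℚ | f v ≟ℚ 0ℚ
    ... | _        | yes _   = z≤n
    ... | no _     | no _    = ℕ.≤-refl
    ... | yes gv≡0 | no fv≢0 = contradiction (g≡0⇒f≡0 v gv≡0) fv≢0

  ∥∥₀-split : ∀ {x f} → VanishesOutside x f →
              ∥ f ∥₀ ≡ 𝟙≢0 (f x) +ℕ ∑ℕ[ child? x ] (λ c → ∥ restrict (desc? c) f ∥₀)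
  ∥∥₀-split {x} {f} outside = begin
    ∥ f ∥₀
      ≡⟨ ∑ℕ-cong pointwise ⟩
    ∑ℕ (λ v → at-x v +ℕ in-branches v)
      ≡⟨ ∑ℕ-distrib at-x in-branches ⟩
    ∑ℕ at-x +ℕ ∑ℕ in-branches
      ≡⟨ cong₂ _+ℕ_ (∑ℕ[]-single (_≟ᶠ x) refl (λ _ v≡x v≢x → contradiction v≡x v≢x))
                   (∑ℕ[]-comm (child? x) (λ c v → 𝟙≢0 (restrict (desc? c) f v))) ⟩
    𝟙≢0 (f x) +ℕ ∑ℕ[ child? x ] (λ c → ∥ restrict (desc? c) f ∥₀)
      ∎
    where
    open ≡-Reasoning
    at-x in-branches : Fin n → ℕ
    at-x v = if does (v ≟ᶠ x) then 𝟙≢0 (f v) else 0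
    in-branches v = ∑ℕ[ child? x ] (λ c → 𝟙≢0 (restrict (desc? c) f v))

    pointwise : ∀ v → 𝟙≢0 (f v) ≡ at-x v +ℕ in-branches v
    pointwise v with v ≟ᶠ x
    ... | yes refl = sym (trans (cong (𝟙≢0 (f x) +ℕ_) (∑ℕ[]-zero (child? x) λ c x▸c →
                       cong 𝟙≢0 (restrict-no (desc? c) f (child-not-above x▸c)))) (ℕ.+-identityʳ _))
    ... | no v≢x with desc? x v
    ...   | no x⋠v  = trans (cong 𝟙≢0 (outside v x⋠v)) (sym (∑ℕ[]-zero (child? x) λ c _ →
                        cong 𝟙≢0 (restrict-zero (desc? c) f (outside v x⋠v))))
    ...   | yes x≼v with ≼-split x≼v v≢x
    ...     | c₀ , x▸c₀ , c₀≼v =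
              sym (trans (∑ℕ[]-single (child? x) x▸c₀ others) (cong 𝟙≢0 (restrict-yes (desc? c₀) f c₀≼v)))
      where
      others : ∀ c → x ▸ c → c ≢ c₀ → 𝟙≢0 (restrict (desc? c) f v) ≡ 0
      others c x▸c c≢c₀ =
        cong 𝟙≢0 (restrict-no (desc? c) f (λ c≼v → c≢c₀ (siblings-disjoint x▸c x▸c₀ c≼v c₀≼v)))

  -- The bounds w̄ ≥ β̄ and w̄ ≤ β̄ on S

  module Betabar {b : Fin n → ℕ} (isB : IsBetabar adj ρ b) where

    b-S : ∀ {x} → InG x → InS x → b x ≡ suc (∑ℕ[ child? x ] b)
    b-S {x} Gx = proj₁ (isB x Gx)

    b-R : ∀ {x} → InG x → ¬ InS x → IsMinChild adj ρ x b (b x)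
    b-R {x} Gx = proj₂ (isB x Gx)

    lower-bound : ∀ x → InG x → InS x → ∀ z → InNS adj ρ x z → z x ≢ 0ℚ → b x ≤ ∥ z ∥₀
    lower-bound = descendant-induction bound
      where
      LowerBound : Fin n → Set
      LowerBound x = InG x → InS x → ∀ z → InNS adj ρ x z → z x ≢ 0ℚ → b x ≤ ∥ z ∥₀

      bound : ∀ x → (∀ {c y} → x ▸ c → c ≼ y → LowerBound y) → LowerBound x
      bound x ih Gx Sx z z∈N@(outside , supp , null) zx≢0 = begin
        b x                             ≡⟨ b-S Gx Sx ⟩
        suc (∑ℕ[ child? x ] b)          ≤⟨ s≤s (∑ℕ[]-mono (child? x) per-child) ⟩
        suc branches                    ≡⟨ cong (_+ℕ branches) (sym (𝟙≢0-nonzero zx≢0)) ⟩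
        𝟙≢0 (z x) +ℕ branches           ≡⟨ sym (∥∥₀-split outside) ⟩
        ∥ z ∥₀                          ∎
        where
        open ℕ.≤-Reasoning
        branches : ℕ
        branches = ∑ℕ[ child? x ] (λ c → ∥ restrict (desc? c) z ∥₀)
        per-child : ∀ c → x ▸ c → b c ≤ ∥ restrict (desc? c) z ∥₀
        per-child c x▸c with any? (λ g → child? c g ×-dec ¬? (z g ≟ℚ 0ℚ))
        ... | no none = contradiction (trans (sym only-x) (null c (step x▸c here))) zx≢0
          where
          only-x : neighbourSum z c ≡ z x
          only-x = neighbourSum-single supp (inj₂ x▸c) others
            where
            others : ∀ v → TreeAdj c v → v ≢ x → z v ≡ 0ℚ
            others v (inj₂ v▸c) v≢x = contradiction (▸-unique v▸c x▸c) v≢x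
            others v (inj₁ c▸v) _ with z v ≟ℚ 0ℚ
            ... | yes zv≡0 = zv≡0
            ... | no zv≢0  = contradiction (v , c▸v , zv≢0) none
        ... | yes (g , c▸g , zg≢0) = begin
          b c                        ≤⟨ proj₂ (b-R (▸-InG-child x▸c) ¬Sc) g c▸g ⟩
          b g                        ≤⟨ ih x▸c (step c▸g here) (▸-InG-child c▸g) (R-child-in-S ¬Sc c▸g)
                                               z₁ z₁∈N z₁g≢0 ⟩
          ∥ z₁ ∥₀                    ≤⟨ ∥∥₀-mono nested ⟩
          ∥ restrict (desc? c) z ∥₀  ∎
          where
          ¬Sc = S-independent x▸c Sx
          z₁ = restrict (desc? g) z
          z₁∈N : InNS adj ρ g z₁
          z₁∈N = subtree-InNS (step x▸c here) c▸g (supp c ¬Sc) z∈N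
          z₁g≢0 : z₁ g ≢ 0ℚ
          z₁g≢0 = zg≢0 ∘ trans (sym (restrict-yes (desc? g) z here))
          nested : ∀ v → restrict (desc? c) z v ≡ 0ℚ → z₁ v ≡ 0ℚ
          nested v zcv≡0 = by-cases (desc? g v)
            where
            by-cases : Dec (g ≼ v) → z₁ v ≡ 0ℚ
            by-cases (yes g≼v) =
              trans (restrict-yes (desc? g) z g≼v) (trans (sym (restrict-yes (desc? c) z (▸-≼ c▸g g≼v))) zcv≡0)
            by-cases (no g⋠v)  = restrict-no (desc? g) z g⋠v

    -- Stated for every q ≠ 0 because the vectors of the grandchildren are needed with value - q.
    upper-bound : ∀ x → InG x → InS x → ∀ q → q ≢ 0ℚ →
                  Σ (Fin n → ℚ) λ z → InNS adj ρ x z × z x ≡ q × ∥ z ∥₀ ≡ b x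
    upper-bound = descendant-induction build
      where
      Optimal : Fin n → ℚ → (Fin n → ℚ) → Set
      Optimal x q z = InNS adj ρ x z × z x ≡ q × ∥ z ∥₀ ≡ b x

      Attained : Fin n → Set
      Attained x = InG x → InS x → ∀ q → q ≢ 0ℚ → Σ (Fin n → ℚ) (Optimal x q)

      build : ∀ x → (∀ {c y} → x ▸ c → c ≼ y → Attained y) → Attained x
      build x ih Gx Sx q q≢0 = z , (z-outside , z-supp , z-null) , z-at-x , z-size
        where
        Branch : Fin n → (Fin n → ℚ) → Set
        Branch c Z = Σ (Fin n) λ g → c ▸ g × InNS adj ρ g Z × Z g ≡ - q × ∥ Z ∥₀ ≡ b c

        branch : ∀ c → x ▸ c → Σ (Fin n → ℚ) (Branch c)
        branch c x▸c =
          let ((g , c▸g , bg≡bc) , _) = b-R (▸-InG-child x▸c) ¬Sc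
              (Z , Z∈N , Zg≡-q , ∥Z∥≡bg) = ih x▸c (step c▸g here) (▸-InG-child c▸g) (R-child-in-S ¬Sc c▸g)
                                               (- q) (q≢0 ∘ ℚ.neg-injective)
          in Z , g , c▸g , Z∈N , Zg≡-q , trans ∥Z∥≡bg bg≡bc
          where
          ¬Sc = S-independent x▸c Sx

        Z : Fin n → Fin n → ℚ
        Z = proj₁ (choose (child? x) (λ _ → 0ℚ) branch)

        Z-branch : ∀ c → x ▸ c → Branch c (Z c)
        Z-branch = proj₂ (choose (child? x) (λ _ → 0ℚ) branch)

        Z-outside : ∀ {c} → x ▸ c → VanishesOutside c (Z c)
        Z-outside {c} x▸c v c⋠v =
          let (g , c▸g , (outside , _) , _) = Z-branch c x▸c in outside v (c⋠v ∘ ▸-≼ c▸g)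

        Z-supp : ∀ {c} → x ▸ c → Supported (Z c)
        Z-supp {c} x▸c = let (_ , _ , (_ , supp , _) , _) = Z-branch c x▸c in supp

        Z-size : ∀ {c} → x ▸ c → ∥ Z c ∥₀ ≡ b c
        Z-size {c} x▸c = let (_ , _ , _ , _ , size) = Z-branch c x▸c in size

        z : Fin n → ℚ
        z v = pointMass x q v + ∑[ child? x ] (λ c → Z c v)

        z-zero : ∀ {v} → v ≢ x → (∀ c → x ▸ c → Z c v ≡ 0ℚ) → z v ≡ 0ℚ
        z-zero v≢x Zv≡0 = trans (cong₂ _+_ (pointMass-off v≢x) (∑[]-ε (child? x) Zv≡0)) (ℚ.+-identityʳ 0ℚ)

        z-outside : VanishesOutside x z
        z-outside v x⋠v = z-zero (λ { refl → x⋠v here }) (λ c x▸c → Z-outside x▸c v (x⋠v ∘ ▸-≼ x▸c))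

        z-supp : Supported z
        z-supp v ¬Sv = z-zero (λ { refl → ¬Sv Sx }) (λ c x▸c → Z-supp x▸c v ¬Sv)

        z-at-x : z x ≡ q
        z-at-x = trans (cong₂ _+_ (pointMass-at x q) (∑[]-ε (child? x) λ c x▸c → Z-outside x▸c x (child-not-above x▸c)))
                       (ℚ.+-identityʳ q)

        z-on-branch : ∀ {c v} → x ▸ c → c ≼ v → z v ≡ Z c v
        z-on-branch {c} {v} x▸c c≼v =
          trans (cong₂ _+_ (pointMass-off v≢x) (∑[]-single (child? x) x▸c others)) (ℚ.+-identityˡ (Z c v))
          where
          v≢x : v ≢ x
          v≢x refl = child-not-above x▸c c≼v
          others : ∀ c′ → x ▸ c′ → c′ ≢ c → Z c′ v ≡ 0ℚ
          others c′ x▸c′ c′≢c =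
            Z-outside x▸c′ v (λ c′≼v → c′≢c (siblings-disjoint x▸c′ x▸c c′≼v c≼v))

        branch-sum : ∀ {u} c → x ▸ c → neighbourSum (Z c) u ≡ pointMass c (- q) u
        branch-sum {u} c x▸c = from-branch (Z-branch c x▸c) (u ≟ᶠ c)
          where
          from-branch : Branch c (Z c) → (u≟c : Dec (u ≡ c)) →
                        neighbourSum (Z c) u ≡ (if does u≟c then - q else 0ℚ)
          from-branch (g , c▸g , (outside , supp , _) , Zg≡-q , _) (yes refl) =
            trans (neighbourSum-at-parent c▸g supp outside) Zg≡-q
          from-branch (g , c▸g , (outside , supp , null) , _ , _) (no u≢c) = inside-or-not (desc? g u)
            where
            inside-or-not : Dec (g ≼ u) → neighbourSum (Z c) u ≡ 0ℚ
            inside-or-not (yes g≼u) = null u g≼u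
            inside-or-not (no g⋠u)  = neighbourSum-outside c▸g supp outside g⋠u u≢c

        z-null : ∀ u → x ≼ u → neighbourSum z u ≡ 0ℚ
        z-null u x≼u = begin
          neighbourSum z u
            ≡⟨ neighbourSum-+ ⟩
          neighbourSum (pointMass x q) u + neighbourSum (λ v → ∑[ child? x ] (λ c → Z c v)) u
            ≡⟨ cong₂ _+_ neighbourSum-pointMass (trans (neighbourSum-∑[] (child? x) Z)
                                                       (∑[]-cong (child? x) branch-sum)) ⟩
          (if adj u x then q else 0ℚ) + ∑[ child? x ] (λ c → pointMass c (- q) u)
            ≡⟨ cancel (child? x u) ⟩
          0ℚ ∎
          where
          open ≡-Reasoning
          cancel : Dec (x ▸ u) → (if adj u x then q else 0ℚ) + ∑[ child? x ] (λ c → pointMass c (- q) u) ≡ 0ℚ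
          cancel (yes x▸u) rewrite treeAdj⇒adj (inj₂ {A = u ▸ x} x▸u) =
            trans (cong (q +_) (trans (∑[]-single (child? x) x▸u λ c _ c≢u → pointMass-off (c≢u ∘ sym))
                                      (pointMass-at u (- q))))
                  (ℚ.+-inverseʳ q)
          cancel (no ¬x▸u) with adj u x in ux
          ... | true  = contradiction (edgeTree u x (ux , inj₂ Sx)) Sum.[ ¬x▸u , (λ u▸x → child-not-above u▸x x≼u) ]′
          ... | false = trans (ℚ.+-identityˡ _) (∑[]-ε (child? x) λ c x▸c →
                          pointMass-off λ u≡c → ¬x▸u (subst (x ▸_) (sym u≡c) x▸c))

        z-size : ∥ z ∥₀ ≡ b x
        z-size = begin
          ∥ z ∥₀                     ≡⟨ ∥∥₀-split z-outside ⟩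
          𝟙≢0 (z x) +ℕ branches      ≡⟨ cong₂ _+ℕ_ (𝟙≢0-nonzero (q≢0 ∘ trans (sym z-at-x)))
                                                   (∑ℕ[]-cong (child? x) branch-size) ⟩
          suc (∑ℕ[ child? x ] b)     ≡⟨ sym (b-S Gx Sx) ⟩
          b x                        ∎
          where
          open ≡-Reasoning
          branches : ℕ
          branches = ∑ℕ[ child? x ] (λ c → ∥ restrict (desc? c) z ∥₀)
          branch-size : ∀ c → x ▸ c → ∥ restrict (desc? c) z ∥₀ ≡ b c
          branch-size c x▸c = trans (∥∥₀-cong restricted) (Z-size x▸c)
            where
            restricted : ∀ v → restrict (desc? c) z v ≡ Z c v
            restricted v = by-cases (desc? c v)
              where
              by-cases : Dec (c ≼ v) → restrict (desc? c) z v ≡ Z c v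
              by-cases (yes c≼v) = trans (restrict-yes (desc? c) z c≼v) (z-on-branch x▸c c≼v)
              by-cases (no c⋠v)  = trans (restrict-no (desc? c) z c⋠v) (sym (Z-outside x▸c v c⋠v))

  IsMinSupp-unique : ∀ {x k k′} → IsMinSupp adj ρ x k → IsMinSupp adj ρ x k′ → k ≡ k′
  IsMinSupp-unique ((z , z∈N , zx≢0 , ∥z∥≡k) , k-min) ((z′ , z′∈N , z′x≢0 , ∥z′∥≡k′) , k′-min) =
    ℕ.≤-antisym (subst (_ ≤_) ∥z′∥≡k′ (k-min z′ z′∈N z′x≢0))
                (subst (_ ≤_) ∥z∥≡k (k′-min z z∈N zx≢0))

  IsMinChild-unique : ∀ {x f g m m′} → (∀ c → x ▸ c → f c ≡ g c) →
                      IsMinChild adj ρ x f m → IsMinChild adj ρ x g m′ → m ≡ m′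
  IsMinChild-unique f≡g ((c , x▸c , fc≡m) , m-min) ((c′ , x▸c′ , gc′≡m′) , m′-min) =
    ℕ.≤-antisym (ℕ.≤-trans (m-min c′ x▸c′) (ℕ.≤-reflexive (trans (f≡g c′ x▸c′) gc′≡m′)))
                (ℕ.≤-trans (m′-min c x▸c) (ℕ.≤-reflexive (trans (sym (f≡g c x▸c)) fc≡m)))

  isBetabar⇒isMinSupp : ∀ {b} → IsBetabar adj ρ b → ∀ {x} → InG x → InS x → IsMinSupp adj ρ x (b x)
  isBetabar⇒isMinSupp isB {x} Gx Sx =
    let (z , z∈N , zx≡1 , ∥z∥≡bx) = upper-bound x Gx Sx 1ℚ (λ ())
    in (z , z∈N , (λ zx≡0 → contradiction (trans (sym zx≡1) zx≡0) λ ()) , ∥z∥≡bx) , lower-bound x Gx Sx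
    where open Betabar isB

  wbar≡betabar : ∀ w b → IsWbar adj ρ w → IsBetabar adj ρ b → ∀ x → InG x → w x ≡ b x
  wbar≡betabar w b isW isB x Gx = by-cases (S? Gx)
    where
    on-S : ∀ {y} → InG y → InS y → w y ≡ b y
    on-S {y} Gy Sy = IsMinSupp-unique (proj₁ (isW y Gy) Sy) (isBetabar⇒isMinSupp isB Gy Sy)
    by-cases : Dec (InS x) → w x ≡ b x
    by-cases (yes Sx)  = on-S Gx Sx
    by-cases (no ¬Sx) = IsMinChild-unique (λ c x▸c → on-S (▸-InG-child x▸c) (R-child-in-S ¬Sx x▸c))
                                          (proj₂ (isW x Gx) ¬Sx) (proj₂ (isB x Gx) ¬Sx)

  -- A solution of the recursion for β̄

  children : Fin n → List (Fin n)
  children x = List.filter (child? x) (allFin n)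

  ∈-children⁺ : ∀ {x c} → x ▸ c → c ∈ children x
  ∈-children⁺ {x} {c} x▸c = ∈-filter⁺ (child? x) (∈-allFin c) x▸c

  ∈-children⁻ : ∀ {x c} → c ∈ children x → x ▸ c
  ∈-children⁻ {x} c∈ = proj₂ (∈-filter⁻ (child? x) {xs = allFin n} c∈)

  minOver-children : ∀ {x c} f → x ▸ c → IsMinChild adj ρ x f (minOver f (children x))
  minOver-children {x} {c} f x▸c =
    let (c′ , c′∈ , fc′≡min) = minOver-attained {f = f} (∈-children⁺ x▸c)
    in (c′ , ∈-children⁻ c′∈ , fc′≡min) , λ c″ x▸c″ → minOver-≤ {f = f} (∈-children⁺ x▸c″)

  β-step : (Fin n → ℕ) → Fin n → ℕ
  β-step f x = if evenLevel x then suc (∑ℕ[ child? x ] f) else minOver f (children x)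

  β-step-cong : ∀ {f g x} → (∀ c → x ▸ c → f c ≡ g c) → β-step f x ≡ β-step g x
  β-step-cong {f} {g} {x} f≡g =
    cong₂ (λ s m → if evenLevel x then suc s else m)
          (∑ℕ[]-cong (child? x) f≡g)
          (minOver-cong (children x) (λ c∈ → f≡g _ (∈-children⁻ c∈)))

  β : ℕ → Fin n → ℕ
  β zero    _ = 0
  β (suc k)   = β-step (β k)

  β-stable : ∀ k x → height x < k → β k x ≡ β (suc k) x
  β-stable (suc k) x h<k = β-step-cong (λ c x▸c → β-stable k c (ℕ.<-≤-trans (▸-height x▸c) (ℕ.≤-pred h<k)))

  b₀ : Fin n → ℕ
  b₀ = β (suc maxDepth)

  b₀-unfold : ∀ x → b₀ x ≡ β-step b₀ x
  b₀-unfold x = β-step-cong λ c x▸c →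
    β-stable maxDepth c (ℕ.<-≤-trans (▸-height x▸c) (ℕ.m∸n≤m maxDepth (depth x)))

  b₀-isBetabar : IsBetabar adj ρ b₀
  b₀-isBetabar x Gx = on-S , on-R
    where
    step-at : ∀ {e} → evenLevel x ≡ e → b₀ x ≡ (if e then suc (∑ℕ[ child? x ] b₀) else minOver b₀ (children x))
    step-at x-level =
      trans (b₀-unfold x) (cong (λ e → if e then suc (∑ℕ[ child? x ] b₀) else minOver b₀ (children x)) x-level)
    on-S : InS x → b₀ x ≡ suc (∑ℕ[ child? x ] b₀)
    on-S Sx = step-at (Equivalence.to (S⇔evenLevel x Gx) Sx)
    on-R : ¬ InS x → IsMinChild adj ρ x b₀ (b₀ x)
    on-R ¬Sx = subst (IsMinChild adj ρ x b₀) (sym (step-at (Bool.¬-not (¬Sx ∘ Equivalence.from (S⇔evenLevel x Gx)))))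
                     (minOver-children b₀ (proj₂ (R-has-child Gx ¬Sx)))

lemma9 : (n : ℕ) (adj : Adjacency n) → IsSimple adj → IsForest adj → (ρ : Rooting adj)
    → Σ (Fin n → ℕ) (IsWbar adj ρ) × Σ (Fin n → ℕ) (IsBetabar adj ρ)
      × (∀ w b → IsWbar adj ρ w → IsBetabar adj ρ b → ∀ x → VG adj x → w x ≡ b x)
lemma9 n adj simple _ ρ =
    (b₀ , λ x Gx → isBetabar⇒isMinSupp b₀-isBetabar Gx , proj₂ (b₀-isBetabar x Gx))
  , (b₀ , b₀-isBetabar)
  , wbar≡betabar
  where open Forest adj simple ρ
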